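{- For a presentation of a pre-d-frame as in the context, ($\lambda^4_+$) holds iff ($\lambda^3_+$) holds, and ($\lambda^4_-$) holds iff ($\lambda^3_-$) holds, where: ($\lambda^3_+$): $\alpha\in\mathsf{con}_{\wedge,\vee,\bigvee}$, $\beta\in\mathsf{tot}_\wedge$, $\beta_+\le\alpha_+$ imply $\alpha_-\le\beta_-$; ($\lambda^3_-$): $\alpha\in\mathsf{con}_{\wedge,\vee,\bigwedge}$, $\beta\in\mathsf{tot}_\vee$, $\beta_-\le\alpha_-$ imply $\alpha_+\le\beta_+$; ($\lambda^4_+$): $\alpha\in\mathsf{con}_{\wedge,\bigvee}$, $\beta\in\mathsf{tot}_\wedge$, $\beta_+\le\alpha_+$ imply $\alpha_-\le\beta_-$; ($\lambda^4_-$): $\alpha\in\mathsf{con}_{\vee,\bigwedge}$, $\beta\in\mathsf{tot}_\vee$, $\beta_-\le\alpha_-$ imply $\alpha_+\le\beta_+$.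
   Context: Let $(B_\pm,\mathcal C_\pm)$ be frame presentations ($B$ a meet-semilattice with top, $\mathcal C$ a set of pairs $U\dashv a$ with $a\in B$, $U\subseteq\downarrow a$, stable: $U\dashv a\in\mathcal C$, $b\le a\Rightarrow\{u\wedge b:u\in U\}\dashv b\in\mathcal C$), $L_\pm$ the frame of $\mathcal C_\pm$-ideals (downsets $I$ with $U\dashv a\in\mathcal C,U\subseteq I\Rightarrow a\in I$, ordered by inclusion), $b\in B_\pm$ identified with the smallest $\mathcal C_\pm$-ideal containing it, and $\mathsf{con}_1,\mathsf{tot}_1\subseteq B_+\times B_-\subseteq L_+\times L_-$. On $L_+\times L_-$: logical join $(\alpha_+\vee\beta_+,\alpha_-\wedge\beta_-)$, logical meet $(\alpha_+\wedge\beta_+,\alpha_-\vee\beta_-)$. $\mathsf{con}_\wedge$, $\mathsf{con}_\vee$, $\mathsf{con}_{\wedge,\vee}$ are the closures of $\mathsf{con}_1$ under finite logical meets, finite logical joins, and both; $\mathsf{tot}_\wedge,\mathsf{tot}_\vee$ analogously for $\mathsf{tot}_1$. For $S\in\{\mathsf{con}_\wedge,\mathsf{con}_{\wedge,\vee}\}$ define $\{(\bigvee_i\alpha^i_+,\bigwedge_i\alpha^i_-):\{\alpha^i\}_i\subseteq S\}$ (arbitrary families), giving $\mathsf{con}_{\wedge,\bigvee}$ and $\mathsf{con}_{\wedge,\vee,\bigvee}$ respectively; for $S\in\{\mathsf{con}_\vee,\mathsf{con}_{\wedge,\vee}\}$ define $\{(\bigwedge_i\alpha^i_+,\bigvee_i\alpha^i_-):\{\alpha^i\}_i\subseteq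 S\}$, giving $\mathsf{con}_{\vee,\bigwedge}$ and $\mathsf{con}_{\wedge,\vee,\bigwedge}$ respectively. -}

module Defs where

open import Level using (Level; _⊔_; suc)
open import Function using (_∘_)
open import Data.Product using (Σ; ∃; _×_; _,_; proj₁; proj₂)
open import Data.Sum using (_⊎_)
open import Data.Unit.Polymorphic using (⊤)
open import Data.Empty.Polymorphic using (⊥)
open import Relation.Unary using (Pred; _⊆_)
open import Relation.Binary.Lattice.Bundles using (BoundedMeetSemilattice)

-- Frame presentations (B , 𝒞)
-- B : meet-semilattice with top; 𝒞 : set of pairs U ⊣ a, given as a
-- predicate  Covers U a  on (subset of B , element of B).

record FramePresentation (ℓ : Level) : Set (suc ℓ) where
  field
    B : BoundedMeetSemilattice ℓ ℓ ℓ
  open BoundedMeetSemilattice B public using (Carrier; _≈_; _≤_; _∧_)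
  field
    Covers      : Pred Carrier ℓ → Carrier → Set ℓ
    cover-below : ∀ {U a} → Covers U a → ∀ {u} → U u → u ≤ a
    stable      : ∀ {U a b} → Covers U a → b ≤ a →
                  Covers (λ x → ∃ λ u → U u × x ≈ (u ∧ b)) b

module IdealFrame {ℓ : Level} (P : FramePresentation ℓ) where
  open FramePresentation P

  IsDown : ∀ {ℓi} → Pred Carrier ℓi → Set (ℓ ⊔ ℓi)
  IsDown I = ∀ {x y} → x ≤ y → I y → I x

  IsCIdeal : ∀ {ℓi} → Pred Carrier ℓi → Set (suc ℓ ⊔ ℓi)
  IsCIdeal I = IsDown I × (∀ {U a} → Covers U a → U ⊆ I → I a)

  record Ideal : Set (suc (suc ℓ)) where
    field
      mem     : Pred Carrier (suc ℓ)
      isIdeal : IsCIdeal mem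
  open Ideal public

  _⊑_ : Ideal → Ideal → Set (suc ℓ)
  I ⊑ J = mem I ⊆ mem J

  data Gen {ℓs} (S : Pred Carrier ℓs) : Pred Carrier (suc ℓ ⊔ ℓs) where
    gen-base : ∀ {x} → S x → Gen S x
    gen-down : ∀ {x y} → x ≤ y → Gen S y → Gen S x
    gen-cov  : ∀ {U a} → Covers U a → (∀ {u} → U u → Gen S u) → Gen S a

  genIdeal : ∀ {ℓs} (S : Pred Carrier ℓs) → IsCIdeal (Gen S)
  genIdeal S = gen-down , λ c h → gen-cov c h

  -- b ∈ B identified with the smallest 𝒞-ideal containing b
  ⟦_⟧ : Carrier → Ideal
  ⟦ b ⟧ = record { mem = Gen (_≤ b) ; isIdeal = genIdeal (_≤ b) }

  ⊤L : Ideal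
  ⊤L = record { mem = λ _ → ⊤ ; isIdeal = (λ _ _ → _) , λ _ _ → _ }

  ⊥L : Ideal
  ⊥L = record { mem = Gen {suc ℓ} (λ _ → ⊥) ; isIdeal = genIdeal {suc ℓ} (λ _ → ⊥) }

  _∧L_ : Ideal → Ideal → Ideal
  I ∧L J = record
    { mem = λ x → mem I x × mem J x
    ; isIdeal = (λ le p → proj₁ (isIdeal I) le (proj₁ p) , proj₁ (isIdeal J) le (proj₂ p))
              , λ c h → proj₂ (isIdeal I) c (proj₁ ∘ h) , proj₂ (isIdeal J) c (proj₂ ∘ h) }

  _∨L_ : Ideal → Ideal → Ideal
  I ∨L J = record
    { mem = Gen (λ x → mem I x ⊎ mem J x)
    ; isIdeal = genIdeal (λ x → mem I x ⊎ mem J x) }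

  ⋁L : {A : Set (suc ℓ)} → (A → Ideal) → Ideal
  ⋁L {A} f = record
    { mem = Gen (λ x → Σ A λ i → mem (f i) x)
    ; isIdeal = genIdeal (λ x → Σ A λ i → mem (f i) x) }

  ⋀L : {A : Set (suc ℓ)} → (A → Ideal) → Ideal
  ⋀L {A} f = record
    { mem = λ x → (i : A) → mem (f i) x
    ; isIdeal = (λ le p i → proj₁ (isIdeal (f i)) le (p i))
              , λ c h i → proj₂ (isIdeal (f i)) c (λ u → h u i) }

record DPresentation (ℓ : Level) : Set (suc ℓ) where
  field
    P₊ P₋ : FramePresentation ℓ
    con₁ tot₁ : FramePresentation.Carrier P₊ → FramePresentation.Carrier P₋ → Set ℓ

module DFrameDefs {ℓ : Level} (D : DPresentation ℓ) where
  open DPresentation D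
  module L₊ = IdealFrame P₊
  module L₋ = IdealFrame P₋
  open FramePresentation P₊ using () renaming (Carrier to B₊)
  open FramePresentation P₋ using () renaming (Carrier to B₋)

  Pair : Set (suc (suc ℓ))
  Pair = L₊.Ideal × L₋.Ideal

  _≃_ : Pair → Pair → Set (suc ℓ)
  α ≃ β = (proj₁ α L₊.⊑ proj₁ β × proj₁ β L₊.⊑ proj₁ α)
        × (proj₂ α L₋.⊑ proj₂ β × proj₂ β L₋.⊑ proj₂ α)

  emb : B₊ → B₋ → Pair
  emb a b = L₊.⟦ a ⟧ , L₋.⟦ b ⟧

  _⋎_ : Pair → Pair → Pair
  α ⋎ β = (proj₁ α L₊.∨L proj₁ β) , (proj₂ α L₋.∧L proj₂ β)

  _⋏_ : Pair → Pair → Pair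
  α ⋏ β = (proj₁ α L₊.∧L proj₁ β) , (proj₂ α L₋.∨L proj₂ β)

  tt : Pair
  tt = L₊.⊤L , L₋.⊥L

  ff : Pair
  ff = L₊.⊥L , L₋.⊤L

  Rel₁ : Set (suc ℓ)
  Rel₁ = B₊ → B₋ → Set ℓ

  data Cl∧ (R : Rel₁) : Pair → Set (suc (suc ℓ)) where
    base : ∀ {a b α} → R a b → α ≃ emb a b → Cl∧ R α
    top  : ∀ {α} → α ≃ tt → Cl∧ R α
    meet : ∀ {α β γ} → Cl∧ R β → Cl∧ R γ → α ≃ (β ⋏ γ) → Cl∧ R α

  data Cl∨ (R : Rel₁) : Pair → Set (suc (suc ℓ)) where
    base : ∀ {a b α} → R a b → α ≃ emb a b → Cl∨ R α
    bot  : ∀ {α} → α ≃ ff → Cl∨ R α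
    join : ∀ {α β γ} → Cl∨ R β → Cl∨ R γ → α ≃ (β ⋎ γ) → Cl∨ R α

  data Cl∧∨ (R : Rel₁) : Pair → Set (suc (suc ℓ)) where
    base : ∀ {a b α} → R a b → α ≃ emb a b → Cl∧∨ R α
    top  : ∀ {α} → α ≃ tt → Cl∧∨ R α
    bot  : ∀ {α} → α ≃ ff → Cl∧∨ R α
    meet : ∀ {α β γ} → Cl∧∨ R β → Cl∧∨ R γ → α ≃ (β ⋏ γ) → Cl∧∨ R α
    join : ∀ {α β γ} → Cl∧∨ R β → Cl∧∨ R γ → α ≃ (β ⋎ γ) → Cl∧∨ R α

  BigJ : (Pair → Set (suc (suc ℓ))) → Pair → Set (suc (suc ℓ))
  BigJ S α = Σ (Set (suc ℓ)) λ A → Σ (A → Pair) λ f →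
             (∀ i → S (f i)) × α ≃ (L₊.⋁L (proj₁ ∘ f) , L₋.⋀L (proj₂ ∘ f))

  BigM : (Pair → Set (suc (suc ℓ))) → Pair → Set (suc (suc ℓ))
  BigM S α = Σ (Set (suc ℓ)) λ A → Σ (A → Pair) λ f →
             (∀ i → S (f i)) × α ≃ (L₊.⋀L (proj₁ ∘ f) , L₋.⋁L (proj₂ ∘ f))

  con∧ con∨ con∧∨ tot∧ tot∨ : Pair → Set (suc (suc ℓ))
  con∧  = Cl∧ con₁
  con∨  = Cl∨ con₁
  con∧∨ = Cl∧∨ con₁
  tot∧  = Cl∧ tot₁
  tot∨  = Cl∨ tot₁

  con∧⋁ con∧∨⋁ con∨⋀ con∧∨⋀ : Pair → Set (suc (suc ℓ))
  con∧⋁  = BigJ con∧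
  con∧∨⋁ = BigJ con∧∨
  con∨⋀  = BigM con∨
  con∧∨⋀ = BigM con∧∨

  λ3₊ λ3₋ λ4₊ λ4₋ : Set (suc (suc ℓ))
  λ3₊ = ∀ α β → con∧∨⋁ α → tot∧ β → proj₁ β L₊.⊑ proj₁ α → proj₂ α L₋.⊑ proj₂ β
  λ3₋ = ∀ α β → con∧∨⋀ α → tot∨ β → proj₂ β L₋.⊑ proj₂ α → proj₁ α L₊.⊑ proj₁ β
  λ4₊ = ∀ α β → con∧⋁ α → tot∧ β → proj₁ β L₊.⊑ proj₁ α → proj₂ α L₋.⊑ proj₂ β
  λ4₋ = ∀ α β → con∨⋀ α → tot∨ β → proj₂ β L₋.⊑ proj₂ α → proj₁ α L₊.⊑ proj₁ β

-- Frame distributivity lets every element of con∧∨ be pushed below a logical join of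
-- elements of con∧: its positive part lies below a join ⋁ᵢ γⁱ₊ and its negative part
-- below every γⁱ₋ (product families for meets, unions of families for joins). So each
-- α ∈ con∧∨⋁ is below some α' ∈ con∧⋁ in both components, and (λ⁴₊) for α' yields
-- (λ³₊) for α; the converse holds because con∧ ⊆ con∧∨. The statements for the
-- negative side are those for the positive side of the presentation with P₊ and P₋
-- exchanged.
module Submission where

open import Defs
open import Level using (Level; suc)
open import Function using (_∘_; flip)
open import Function.Bundles using (_⇔_; mk⇔)
open import Data.Product using (Σ; _×_; _,_; proj₁; proj₂; swap)
open import Data.Sum using (_⊎_; inj₁; inj₂; [_,_]′)
open import Data.Unit.Polymorphic using (⊤)
open import Data.Empty.Polymorphic using (⊥)
open import Relation.Unary using (Pred; _⊆_; _∩_)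
open import Relation.Binary.Lattice.Bundles using (BoundedMeetSemilattice)

module IdealFrameProperties {ℓ : Level} (P : FramePresentation ℓ) where
  open FramePresentation P
  open IdealFrame P
  open BoundedMeetSemilattice B using (refl; trans; reflexive; x∧y≤x; x∧y≤y)

  private
    variable
      ℓs : Level
      S T : Pred Carrier ℓs
      A C : Set (suc ℓ)

  Gen-least : IsCIdeal T → S ⊆ T → Gen S ⊆ T
  Gen-least T-ideal S⊆T (gen-base s)      = S⊆T s
  Gen-least T-ideal S⊆T (gen-down x≤y g)  = proj₁ T-ideal x≤y (Gen-least T-ideal S⊆T g)
  Gen-least T-ideal S⊆T (gen-cov cover g) = proj₂ T-ideal cover (Gen-least T-ideal S⊆T ∘ g)

  Gen-mono : S ⊆ T → Gen S ⊆ Gen T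
  Gen-mono S⊆T = Gen-least (genIdeal _) (gen-base ∘ S⊆T)

  -- Stability of the covers is what makes meets distribute over generated joins.
  Gen-∩-down : IsDown S → IsDown T → ∀ {x y} → Gen S x → y ≤ x → T y → Gen (S ∩ T) y
  Gen-∩-down S-down T-down (gen-base s) y≤x t = gen-base (S-down y≤x s , t)
  Gen-∩-down S-down T-down (gen-down x≤z g) y≤x t =
    Gen-∩-down S-down T-down g (trans y≤x x≤z) t
  Gen-∩-down S-down T-down {y = y} (gen-cov cover g) y≤a t =
    gen-cov (stable cover y≤a) λ { (u , uU , x≈u∧y) →
      Gen-∩-down S-down T-down (g uU) (trans (reflexive x≈u∧y) (x∧y≤x u y))
        (T-down (trans (reflexive x≈u∧y) (x∧y≤y u y)) t) }

  ⋁L-subfamily : (f : A → Ideal) (σ : C → A) → ⋁L (f ∘ σ) ⊑ ⋁L f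
  ⋁L-subfamily f σ = Gen-mono λ (i , p) → σ i , p

  ∧L-⋁L-distrib : (f : A → Ideal) (h : C → Ideal) →
                  (⋁L f ∧L ⋁L h) ⊑ ⋁L (λ ij → f (proj₁ ij) ∧L h (proj₂ ij))
  ∧L-⋁L-distrib f h (p , q) =
    Gen-least (genIdeal _) pair-up (Gen-∩-down (family-down f) gen-down p refl q)
    where
    family-down : {A : Set (suc ℓ)} (f : A → Ideal) → IsDown (λ x → Σ A λ i → mem (f i) x)
    family-down f y≤x (i , p) = i , proj₁ (isIdeal (f i)) y≤x p

    pair-up : (λ x → Σ _ (λ i → mem (f i) x)) ∩ mem (⋁L h) ⊆
              mem (⋁L (λ ij → f (proj₁ ij) ∧L h (proj₂ ij)))
    pair-up ((i , p) , q) =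
      Gen-mono (λ ((j , r) , p′) → (i , j) , p′ , r)
        (Gen-∩-down (family-down h) (proj₁ (isIdeal (f i))) q refl p)

module Bounds {ℓ : Level} (D : DPresentation ℓ) where
  open DPresentation D
  open DFrameDefs D
  open IdealFrameProperties P₊ using (Gen-least; Gen-mono; ⋁L-subfamily; ∧L-⋁L-distrib)
  open IdealFrameProperties P₋ using () renaming (Gen-mono to Gen₋-mono)

  private
    variable
      R : Rel₁
      α β γ : Pair

  ≃-refl : α ≃ α
  ≃-refl = ((λ p → p) , (λ p → p)) , ((λ p → p) , (λ p → p))

  ⋁⋀ : {A : Set (suc ℓ)} → (A → Pair) → Pair
  ⋁⋀ f = L₊.⋁L (proj₁ ∘ f) , L₋.⋀L (proj₂ ∘ f)

  record Cl∧Bound (R : Rel₁) (γ : Pair) : Set (suc (suc ℓ)) where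
    field
      Index      : Set (suc ℓ)
      family     : Index → Pair
      family-Cl∧ : ∀ i → Cl∧ R (family i)
      below₊     : proj₁ γ L₊.⊑ L₊.⋁L (proj₁ ∘ family)
      below₋     : ∀ i → proj₂ γ L₋.⊑ proj₂ (family i)

  open Cl∧Bound

  bound-resp-≃ : α ≃ β → Cl∧Bound R β → Cl∧Bound R α
  bound-resp-≃ ((α₊⊑β₊ , _) , (α₋⊑β₋ , _)) c = record
    { Index = Index c ; family = family c ; family-Cl∧ = family-Cl∧ c
    ; below₊ = λ p → below₊ c (α₊⊑β₊ p) ; below₋ = λ i p → below₋ c i (α₋⊑β₋ p) }

  bound-Cl∧ : Cl∧ R γ → Cl∧Bound R γ
  bound-Cl∧ {γ = γ} γ∈ = record
    { Index = ⊤ ; family = λ _ → γ ; family-Cl∧ = λ _ → γ∈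
    ; below₊ = λ p → L₊.gen-base (_ , p) ; below₋ = λ _ p → p }

  bound-ff : Cl∧Bound R ff
  bound-ff = record
    { Index = ⊥ ; family = λ () ; family-Cl∧ = λ ()
    ; below₊ = Gen-mono λ () ; below₋ = λ () }

  bound-⋎ : Cl∧Bound R β → Cl∧Bound R γ → Cl∧Bound R (β ⋎ γ)
  bound-⋎ b c = record
    { Index = Index b ⊎ Index c
    ; family = g
    ; family-Cl∧ = λ { (inj₁ i) → family-Cl∧ b i ; (inj₂ j) → family-Cl∧ c j }
    ; below₊ = Gen-least (L₊.genIdeal _) λ
        { (inj₁ p) → ⋁L-subfamily (proj₁ ∘ g) inj₁ (below₊ b p)
        ; (inj₂ q) → ⋁L-subfamily (proj₁ ∘ g) inj₂ (below₊ c q) }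
    ; below₋ = λ { (inj₁ i) (p , _) → below₋ b i p ; (inj₂ j) (_ , q) → below₋ c j q } }
    where
    g : Index b ⊎ Index c → Pair
    g = [ family b , family c ]′

  bound-⋏ : Cl∧Bound R β → Cl∧Bound R γ → Cl∧Bound R (β ⋏ γ)
  bound-⋏ b c = record
    { Index = Index b × Index c
    ; family = λ (i , j) → family b i ⋏ family c j
    ; family-Cl∧ = λ (i , j) →
        meet (family-Cl∧ b i) (family-Cl∧ c j) (≃-refl {α = family b i ⋏ family c j})
    ; below₊ = λ (p , q) →
        ∧L-⋁L-distrib (proj₁ ∘ family b) (proj₁ ∘ family c) (below₊ b p , below₊ c q)
    ; below₋ = λ (i , j) → Gen₋-mono λ
        { (inj₁ p) → inj₁ (below₋ b i p)
        ; (inj₂ q) → inj₂ (below₋ c j q) } }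

  bound-⋁⋀ : {A : Set (suc ℓ)} {f : A → Pair} → (∀ i → Cl∧Bound R (f i)) → Cl∧Bound R (⋁⋀ f)
  bound-⋁⋀ c = record
    { Index = Σ _ (Index ∘ c)
    ; family = g
    ; family-Cl∧ = λ (i , j) → family-Cl∧ (c i) j
    ; below₊ = Gen-least (L₊.genIdeal _) λ (i , p) →
        ⋁L-subfamily (proj₁ ∘ g) (i ,_) (below₊ (c i) p)
    ; below₋ = λ (i , j) p → below₋ (c i) j (p i) }
    where
    g : Σ _ (Index ∘ c) → Pair
    g (i , j) = family (c i) j

  Cl∧∨⇒bound : Cl∧∨ R γ → Cl∧Bound R γ
  Cl∧∨⇒bound (base r e)   = bound-Cl∧ (base r e)
  Cl∧∨⇒bound (top e)      = bound-Cl∧ (top e)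
  Cl∧∨⇒bound (bot e)      = bound-resp-≃ e bound-ff
  Cl∧∨⇒bound (meet b c e) = bound-resp-≃ e (bound-⋏ (Cl∧∨⇒bound b) (Cl∧∨⇒bound c))
  Cl∧∨⇒bound (join b c e) = bound-resp-≃ e (bound-⋎ (Cl∧∨⇒bound b) (Cl∧∨⇒bound c))

  BigJ-Cl∧∨⇒bound : BigJ (Cl∧∨ R) α → Cl∧Bound R α
  BigJ-Cl∧∨⇒bound (_ , _ , f∈ , e) = bound-resp-≃ e (bound-⋁⋀ (Cl∧∨⇒bound ∘ f∈))

  Cl∧⇒Cl∧∨ : Cl∧ R γ → Cl∧∨ R γ
  Cl∧⇒Cl∧∨ (base r e)   = base r e
  Cl∧⇒Cl∧∨ (top e)      = top e
  Cl∧⇒Cl∧∨ (meet b c e) = meet (Cl∧⇒Cl∧∨ b) (Cl∧⇒Cl∧∨ c) e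

  Cl∨⇒Cl∧∨ : Cl∨ R γ → Cl∧∨ R γ
  Cl∨⇒Cl∧∨ (base r e)   = base r e
  Cl∨⇒Cl∧∨ (bot e)      = bot e
  Cl∨⇒Cl∧∨ (join b c e) = join (Cl∨⇒Cl∧∨ b) (Cl∨⇒Cl∧∨ c) e

  λ4₊⇒λ3₊ : λ4₊ → λ3₊
  λ4₊⇒λ3₊ λ4 α β α∈ β∈ β₊⊑α₊ p = bound₋⊑β₋ λ i → below₋ c i p
    where
    c : Cl∧Bound con₁ α
    c = BigJ-Cl∧∨⇒bound α∈
    bound₋⊑β₋ : L₋.⋀L (proj₂ ∘ family c) L₋.⊑ proj₂ β
    bound₋⊑β₋ = λ4 (⋁⋀ (family c)) β
                   (Index c , family c , family-Cl∧ c , ≃-refl {α = ⋁⋀ (family c)})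
                   β∈ (λ p → below₊ c (β₊⊑α₊ p))

  λ3₊⇒λ4₊ : λ3₊ → λ4₊
  λ3₊⇒λ4₊ λ3 α β (A , f , f∈ , e) = λ3 α β (A , f , Cl∧⇒Cl∧∨ ∘ f∈ , e)

  λ3₋⇒λ4₋ : λ3₋ → λ4₋
  λ3₋⇒λ4₋ λ3 α β (A , f , f∈ , e) = λ3 α β (A , f , Cl∨⇒Cl∧∨ ∘ f∈ , e)

dual : ∀ {ℓ} → DPresentation ℓ → DPresentation ℓ
dual D = record { P₊ = P₋ ; P₋ = P₊ ; con₁ = flip con₁ ; tot₁ = flip tot₁ }
  where open DPresentation D

module Duality {ℓ : Level} (D : DPresentation ℓ) where
  open DFrameDefs D
  module Dᵈ = DFrameDefs (dual D)

  private
    variable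
      R : Rel₁
      α : Pair
      S  : Pair → Set (suc (suc ℓ))
      Sᵈ : Dᵈ.Pair → Set (suc (suc ℓ))

  Cl∧⇒Cl∨ᵈ : Cl∧ R α → Dᵈ.Cl∨ (flip R) (swap α)
  Cl∧⇒Cl∨ᵈ (base r e)   = Dᵈ.base r (swap e)
  Cl∧⇒Cl∨ᵈ (top e)      = Dᵈ.bot (swap e)
  Cl∧⇒Cl∨ᵈ (meet b c e) = Dᵈ.join (Cl∧⇒Cl∨ᵈ b) (Cl∧⇒Cl∨ᵈ c) (swap e)

  Cl∨⇒Cl∧ᵈ : Cl∨ R α → Dᵈ.Cl∧ (flip R) (swap α)
  Cl∨⇒Cl∧ᵈ (base r e)   = Dᵈ.base r (swap e)
  Cl∨⇒Cl∧ᵈ (bot e)      = Dᵈ.top (swap e)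
  Cl∨⇒Cl∧ᵈ (join b c e) = Dᵈ.meet (Cl∨⇒Cl∧ᵈ b) (Cl∨⇒Cl∧ᵈ c) (swap e)

  Cl∧∨⇒Cl∧∨ᵈ : Cl∧∨ R α → Dᵈ.Cl∧∨ (flip R) (swap α)
  Cl∧∨⇒Cl∧∨ᵈ (base r e)   = Dᵈ.base r (swap e)
  Cl∧∨⇒Cl∧∨ᵈ (top e)      = Dᵈ.bot (swap e)
  Cl∧∨⇒Cl∧∨ᵈ (bot e)      = Dᵈ.top (swap e)
  Cl∧∨⇒Cl∧∨ᵈ (meet b c e) = Dᵈ.join (Cl∧∨⇒Cl∧∨ᵈ b) (Cl∧∨⇒Cl∧∨ᵈ c) (swap e)
  Cl∧∨⇒Cl∧∨ᵈ (join b c e) = Dᵈ.meet (Cl∧∨⇒Cl∧∨ᵈ b) (Cl∧∨⇒Cl∧∨ᵈ c) (swap e)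

  BigJ⇒BigMᵈ : (∀ {γ} → S γ → Sᵈ (swap γ)) → BigJ S α → Dᵈ.BigM Sᵈ (swap α)
  BigJ⇒BigMᵈ S⇒Sᵈ (A , f , f∈ , e) = A , swap ∘ f , S⇒Sᵈ ∘ f∈ , swap e

  BigM⇒BigJᵈ : (∀ {γ} → S γ → Sᵈ (swap γ)) → BigM S α → Dᵈ.BigJ Sᵈ (swap α)
  BigM⇒BigJᵈ S⇒Sᵈ (A , f , f∈ , e) = A , swap ∘ f , S⇒Sᵈ ∘ f∈ , swap e

module Symmetry {ℓ : Level} (D : DPresentation ℓ) where
  open DFrameDefs D
  module Dᵈ = DFrameDefs (dual D)
  open Duality D using (Cl∨⇒Cl∧ᵈ; Cl∧∨⇒Cl∧∨ᵈ; BigM⇒BigJᵈ)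
  -- dual (dual D) is D definitionally, so these transport from the dual back to D.
  open Duality (dual D) using (Cl∧⇒Cl∨ᵈ; BigJ⇒BigMᵈ)

  λ4₋⇒λ4₊ᵈ : λ4₋ → Dᵈ.λ4₊
  λ4₋⇒λ4₊ᵈ λ4 α β α∈ β∈ =
    λ4 (swap α) (swap β) (BigJ⇒BigMᵈ {S = Dᵈ.con∧} {Sᵈ = con∨} {α = α} Cl∧⇒Cl∨ᵈ α∈) (Cl∧⇒Cl∨ᵈ β∈)

  λ3₊ᵈ⇒λ3₋ : Dᵈ.λ3₊ → λ3₋
  λ3₊ᵈ⇒λ3₋ λ3 α β α∈ β∈ =
    λ3 (swap α) (swap β) (BigM⇒BigJᵈ {S = con∧∨} {Sᵈ = Dᵈ.con∧∨} {α = α} Cl∧∨⇒Cl∧∨ᵈ α∈)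
       (Cl∨⇒Cl∧ᵈ β∈)

lemma14 : ∀ {ℓ} (D : DPresentation ℓ) →
          (DFrameDefs.λ4₊ D ⇔ DFrameDefs.λ3₊ D) × (DFrameDefs.λ4₋ D ⇔ DFrameDefs.λ3₋ D)
lemma14 D = mk⇔ λ4₊⇒λ3₊ λ3₊⇒λ4₊
          , mk⇔ (λ3₊ᵈ⇒λ3₋ ∘ Bounds.λ4₊⇒λ3₊ (dual D) ∘ λ4₋⇒λ4₊ᵈ) λ3₋⇒λ4₋
  where
  open Bounds D
  open Symmetry D
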